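{- Let $K$ be a field and $R\subsetneq K$ a henselian local domain with fraction field $K$. Then the $R$-adic topology on $K$ is gt-henselian.
   Context: The $R$-adic topology on $K$ has basis $\{aR+b: a\in K^\times, b\in K\}$ (a field topology here). A field topology is gt-henselian if for every $n$ and every neighbourhood $P$ of $-1$ there is a neighbourhood $O$ of $0$ such that $X^{n+1}+X^n+a_{n-1}X^{n-1}+\dots+a_1X+a_0$ has a root in $P$ for all $a_0,\dots,a_{n-1}\in O$. A local ring $(R,\mathfrak m)$ is henselian if simple roots modulo $\mathfrak m$ of polynomials over $R$ lift to roots in $R$. -}

module Defs where

open import Level using (Level; _⊔_) renaming (suc to lsuc)
open import Data.Nat using (ℕ; zero; suc)
open import Data.Fin using (Fin; zero; suc)
open import Data.List using (List; []; _∷_)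
open import Data.List.Relation.Unary.All using (All)
open import Data.Product using (Σ; ∃; _×_; _,_)
open import Relation.Nullary using (¬_)
open import Relation.Unary using (Pred; _⊆_)
open import Algebra.Bundles using (CommutativeRing)

record Field (c ℓ : Level) : Set (lsuc (c ⊔ ℓ)) where
  field
    commutativeRing : CommutativeRing c ℓ
  open CommutativeRing commutativeRing public
  field
    1≉0 : ¬ (1# ≈ 0#)
    inverse : ∀ x → ¬ (x ≈ 0#) → ∃ λ y → x * y ≈ 1#

module FieldTheory {c ℓ : Level} (K : Field c ℓ) where
  open Field K hiding (zero)

  pow : Carrier → ℕ → Carrier
  pow x zero = 1#
  pow x (suc n) = x * pow x n

  Σ[_] : ∀ {n} → (Fin n → Carrier) → Carrier
  Σ[_] {zero} f = 0#
  Σ[_] {suc n} f = f zero + Σ[_] (λ i → f (suc i))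

  -- polynomials as coefficient lists, constant coefficient first
  Poly : Set c
  Poly = List Carrier

  eval : Poly → Carrier → Carrier
  eval [] x = 0#
  eval (a ∷ f) x = a + x * eval f x

  deriv : Poly → Poly
  deriv [] = []
  deriv (a ∷ f) = go 1# f
    where
    go : Carrier → Poly → Poly
    go k [] = []
    go k (b ∷ g) = (k * b) ∷ go (k + 1#) g

  record IsSubring {r : Level} (R : Pred Carrier r) : Set (c ⊔ ℓ ⊔ r) where
    field
      resp : ∀ {x y} → x ≈ y → R x → R y
      0∈ : R 0#
      1∈ : R 1#
      +∈ : ∀ {x y} → R x → R y → R (x + y)
      -∈ : ∀ {x} → R x → R (- x)
      *∈ : ∀ {x y} → R x → R y → R (x * y)

  module _ {r : Level} (R : Pred Carrier r) where

    UnitR : Pred Carrier (c ⊔ ℓ ⊔ r)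
    UnitR x = R x × ∃ λ y → R y × x * y ≈ 1#

    -- the non-units of R (the maximal ideal when R is local)
    𝔪 : Pred Carrier (c ⊔ ℓ ⊔ r)
    𝔪 x = R x × ¬ UnitR x

    -- R is local: the non-units form an ideal (closed under addition;
    -- closure under R-multiples is automatic), and 1 is a unit so 𝔪 is proper.
    IsLocal : Set (c ⊔ ℓ ⊔ r)
    IsLocal = ∀ {x y} → 𝔪 x → 𝔪 y → 𝔪 (x + y)

    IsHenselian : Set (c ⊔ ℓ ⊔ r)
    IsHenselian = ∀ (f : Poly) → All R f → ∀ a → R a →
      𝔪 (eval f a) → ¬ 𝔪 (eval (deriv f) a) →
      ∃ λ b → R b × eval f b ≈ 0# × 𝔪 (b - a)

    IsFractionField : Set (c ⊔ ℓ ⊔ r)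
    IsFractionField = ∀ x → ∃ λ s → ∃ λ t → R s × R t × ¬ (t ≈ 0#) × x * t ≈ s

    IsProper : Set (c ⊔ r)
    IsProper = ∃ λ x → ¬ R x

    Basic : Carrier → Carrier → Pred Carrier (c ⊔ ℓ ⊔ r)
    Basic a b x = ∃ λ s → R s × x ≈ a * s + b

    IsNbhd : Pred Carrier (c ⊔ ℓ ⊔ r) → Carrier → Set (c ⊔ ℓ ⊔ r)
    IsNbhd P x = ∃ λ a → ∃ λ b → ¬ (a ≈ 0#) × Basic a b x × (Basic a b ⊆ P)

    gtPoly : (n : ℕ) → (Fin n → Carrier) → Carrier → Carrier
    gtPoly n as x = pow x (suc n) + pow x n + Σ[ (λ i → as i * pow x (Data.Fin.toℕ i)) ]

    IsGtHenselian : Set (lsuc (c ⊔ ℓ ⊔ r))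
    IsGtHenselian = ∀ (n : ℕ) (P : Pred Carrier (c ⊔ ℓ ⊔ r)) → IsNbhd P (- 1#) →
      ∃ λ (O : Pred Carrier (c ⊔ ℓ ⊔ r)) → IsNbhd O 0# ×
        (∀ (as : Fin n → Carrier) → (∀ i → O (as i)) →
           ∃ λ x → P x × gtPoly n as x ≈ 0#)

{-# OPTIONS --safe #-}
-- Let aR + b ⊆ P be a basic neighbourhood of −1. Since R ≠ K = Frac R there is a nonzero
-- non-unit d ∈ aR; take O = d²R. If all a_i ∈ d²R, then f = X^(n+1) + X^n + … + a_0 has
-- f(−1) ∈ d²R and f′(−1) ∈ (−1)^n + d²R, a unit. By Taylor expansion f(−1 + dY) = d·g(Y)
-- with g ∈ R[Y], g(0) = f(−1)/d ∈ 𝔪 and g′(0) = f′(−1) ∉ 𝔪, so henselianity gives a root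
-- y ∈ R of g, and −1 + dy ∈ −1 + aR ⊆ P is a root of f.
module Submission where

open import Defs
open import Level using (Level; _⊔_)
open import Relation.Unary using (Pred)
open import Data.Nat using (ℕ; zero; suc)
open import Data.Fin using (Fin; zero; suc; toℕ)
open import Data.List using ([]; _∷_; map)
open import Data.List.Relation.Unary.All as All using (All; []; _∷_)
open import Data.List.Relation.Unary.All.Properties using (map⁺)
open import Data.Product using (∃; _×_; _,_; proj₁; proj₂)
open import Relation.Nullary using (¬_)

module Polynomials {c ℓ : Level} (K : Field c ℓ) where

  open Field K hiding (zero)
  open FieldTheory K
  open import Relation.Binary.Reasoning.Setoid setoid
  open import Algebra.Solver.Ring.NaturalCoefficients.Default commutativeSemiring
    using (solve; _:+_; _:*_; _:=_; con)

  -- f′(x) computed from (a + X g)′ = g + X g′ rather than through deriv.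
  evalDeriv : Poly → Carrier → Carrier
  evalDeriv []      x = 0#
  evalDeriv (a ∷ f) x = eval f x + x * evalDeriv f x

  eval-at-0 : ∀ a f → eval (a ∷ f) 0# ≈ a
  eval-at-0 a f = trans (+-cong refl (zeroˡ _)) (+-identityʳ a)

  eval-deriv-at-0 : ∀ a b f → eval (deriv (a ∷ b ∷ f)) 0# ≈ b
  eval-deriv-at-0 a b f = trans (+-cong (*-identityˡ b) (zeroˡ _)) (+-identityʳ b)

  eval-scale : ∀ d f x → eval (map (d *_) f) x ≈ d * eval f x
  eval-scale d []      x = sym (zeroʳ d)
  eval-scale d (b ∷ f) x = trans (+-cong refl (*-cong refl (eval-scale d f x)))
    (solve 4 (λ d b x F → d :* b :+ x :* (d :* F) := d :* (b :+ x :* F)) refl d b x (eval f x))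

  addConst : Carrier → Poly → Poly
  addConst b []      = b ∷ []
  addConst b (a ∷ f) = (b + a) ∷ f

  eval-addConst : ∀ b f x → eval (addConst b f) x ≈ b + eval f x
  eval-addConst b []      x = +-cong refl (zeroʳ x)
  eval-addConst b (a ∷ f) x = +-assoc b a _

  mulAffine : Carrier → Carrier → Poly → Poly
  mulAffine a d []      = []
  mulAffine a d (b ∷ f) = (a * b) ∷ addConst (d * b) (mulAffine a d f)

  eval-mulAffine : ∀ a d f x → eval (mulAffine a d f) x ≈ (a + d * x) * eval f x
  eval-mulAffine a d []      x = sym (zeroʳ _)
  eval-mulAffine a d (b ∷ f) x = begin
      a * b + x * eval (addConst (d * b) (mulAffine a d f)) x
    ≈⟨ +-cong refl (*-cong refl (trans (eval-addConst (d * b) (mulAffine a d f) x)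
                                       (+-cong refl (eval-mulAffine a d f x)))) ⟩
      a * b + x * (d * b + (a + d * x) * F)
    ≈⟨ solve 5 (λ a b d x F → a :* b :+ x :* (d :* b :+ (a :+ d :* x) :* F) := (a :+ d :* x) :* (b :+ x :* F))
         refl a b d x F ⟩
      (a + d * x) * (b + x * F)
    ∎
    where F = eval f x

  -- If f(a + z) = V + z W + z² Q, then (b + X f)(a + z) = (b + a V) + z (V + a W) + z² (W + (a + z) Q).
  taylorTail : Carrier → Carrier → Poly → Poly
  taylorTail a d []      = []
  taylorTail a d (b ∷ f) = addConst (evalDeriv f a) (mulAffine a d (taylorTail a d f))

  taylor : ∀ f a d y → eval f (a + d * y) ≈
    eval f a + (d * y) * evalDeriv f a + (d * d) * (y * y * eval (taylorTail a d f) y)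
  taylor []      a d y = solve 3 (λ a d y → con 0 := con 0 :+ (d :* y) :* con 0 :+ (d :* d) :* (y :* y :* con 0))
    refl a d y
  taylor (b ∷ f) a d y = begin
      b + (a + d * y) * eval f (a + d * y)
    ≈⟨ +-cong refl (*-cong refl (taylor f a d y)) ⟩
      b + (a + d * y) * (V + (d * y) * W + (d * d) * (y * y * Q))
    ≈⟨ solve 7 (λ b a d y V W Q →
           b :+ (a :+ d :* y) :* (V :+ (d :* y) :* W :+ (d :* d) :* (y :* y :* Q))
         := b :+ a :* V :+ (d :* y) :* (V :+ a :* W) :+ (d :* d) :* (y :* y :* (W :+ (a :+ d :* y) :* Q)))
         refl b a d y V W Q ⟩
      b + a * V + (d * y) * (V + a * W) + (d * d) * (y * y * (W + (a + d * y) * Q))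
    ≈⟨ +-cong refl (*-cong refl (*-cong refl (sym tail-eval))) ⟩
      eval (b ∷ f) a + (d * y) * evalDeriv (b ∷ f) a + (d * d) * (y * y * eval (taylorTail a d (b ∷ f)) y)
    ∎
    where
    V = eval f a
    W = evalDeriv f a
    Q = eval (taylorTail a d f) y
    tail-eval : eval (taylorTail a d (b ∷ f)) y ≈ W + (a + d * y) * Q
    tail-eval = trans (eval-addConst W (mulAffine a d (taylorTail a d f)) y)
                      (+-cong refl (eval-mulAffine a d (taylorTail a d f) y))

  taylorQuotient : Carrier → Carrier → Carrier → Poly → Poly
  taylorQuotient a d t f = d * t ∷ evalDeriv f a ∷ map (d *_) (taylorTail a d f)

  eval-taylorQuotient : ∀ f a d t y → eval f a ≈ (d * d) * t →
    eval f (a + d * y) ≈ d * eval (taylorQuotient a d t f) y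
  eval-taylorQuotient f a d t y fa≈d²t = begin
      eval f (a + d * y)
    ≈⟨ taylor f a d y ⟩
      eval f a + (d * y) * W + (d * d) * (y * y * Q)
    ≈⟨ +-cong (+-cong fa≈d²t refl) refl ⟩
      (d * d) * t + (d * y) * W + (d * d) * (y * y * Q)
    ≈⟨ solve 5 (λ d t y W Q → (d :* d) :* t :+ (d :* y) :* W :+ (d :* d) :* (y :* y :* Q)
                            := d :* (d :* t :+ y :* (W :+ y :* (d :* Q)))) refl d t y W Q ⟩
      d * (d * t + y * (W + y * (d * Q)))
    ≈⟨ *-cong refl (+-cong refl (*-cong refl (+-cong refl (*-cong refl (sym Q-scaled))))) ⟩
      d * eval (taylorQuotient a d t f) y
    ∎
    where
    W = evalDeriv f a
    Q = eval (taylorTail a d f) y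
    Q-scaled : eval (map (d *_) (taylorTail a d f)) y ≈ d * Q
    Q-scaled = eval-scale d (taylorTail a d f) y

  Σ-pull-factor : ∀ {m} (b p : Fin m → Carrier) x →
    Σ[ (λ i → b i * (x * p i)) ] ≈ x * Σ[ (λ i → b i * p i) ]
  Σ-pull-factor {zero}  b p x = sym (zeroʳ x)
  Σ-pull-factor {suc m} b p x = trans (+-cong refl (Σ-pull-factor (λ i → b (suc i)) (λ i → p (suc i)) x))
    (solve 4 (λ b p x S → b :* (x :* p) :+ x :* S := x :* (b :* p :+ S)) refl (b zero) (p zero) x
       Σ[ (λ i → b (suc i) * p (suc i)) ])

module Subrings {c ℓ r : Level} (K : Field c ℓ) (R : Pred (Field.Carrier K) r)
                (R-subring : FieldTheory.IsSubring K R) where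

  open Field K hiding (zero)
  open FieldTheory K
  open IsSubring R-subring
  open Polynomials K
  open import Relation.Binary.Reasoning.Setoid setoid
  open import Algebra.Properties.Ring ring using (-1*x≈-x; -‿distribʳ-*; -‿involutive)
  open import Algebra.Solver.Ring.NaturalCoefficients.Default commutativeSemiring
    using (solve; _:+_; _:*_; _:=_; con)

  x*y≈0⇒y≈0 : ∀ {x y} → ¬ x ≈ 0# → x * y ≈ 0# → y ≈ 0#
  x*y≈0⇒y≈0 {x} {y} x≉0 xy≈0 with inverse x x≉0
  ... | x⁻¹ , xx⁻¹≈1 = begin
    y              ≈⟨ sym (*-identityˡ y) ⟩
    1# * y         ≈⟨ *-cong (sym xx⁻¹≈1) refl ⟩
    (x * x⁻¹) * y  ≈⟨ solve 3 (λ x x⁻¹ y → (x :* x⁻¹) :* y := x⁻¹ :* (x :* y)) refl x x⁻¹ y ⟩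
    x⁻¹ * (x * y)  ≈⟨ *-cong refl xy≈0 ⟩
    x⁻¹ * 0#       ≈⟨ zeroʳ x⁻¹ ⟩
    0#             ∎

  *-≉0 : ∀ {x y} → ¬ x ≈ 0# → ¬ y ≈ 0# → ¬ x * y ≈ 0#
  *-≉0 x≉0 y≉0 xy≈0 = y≉0 (x*y≈0⇒y≈0 x≉0 xy≈0)

  eval∈R : ∀ {f x} → All R f → R x → R (eval f x)
  eval∈R []          x∈R = 0∈
  eval∈R (a∈R ∷ f∈R) x∈R = +∈ a∈R (*∈ x∈R (eval∈R f∈R x∈R))

  evalDeriv∈R : ∀ {f x} → All R f → R x → R (evalDeriv f x)
  evalDeriv∈R []          x∈R = 0∈
  evalDeriv∈R (a∈R ∷ f∈R) x∈R = +∈ (eval∈R f∈R x∈R) (*∈ x∈R (evalDeriv∈R f∈R x∈R))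

  scale∈R : ∀ {d f} → R d → All R f → All R (map (d *_) f)
  scale∈R d∈R f∈R = map⁺ (All.map (*∈ d∈R) f∈R)

  addConst∈R : ∀ {b f} → R b → All R f → All R (addConst b f)
  addConst∈R b∈R []          = b∈R ∷ []
  addConst∈R b∈R (a∈R ∷ f∈R) = +∈ b∈R a∈R ∷ f∈R

  mulAffine∈R : ∀ {a d f} → R a → R d → All R f → All R (mulAffine a d f)
  mulAffine∈R a∈R d∈R []          = []
  mulAffine∈R a∈R d∈R (b∈R ∷ f∈R) =
    *∈ a∈R b∈R ∷ addConst∈R (*∈ d∈R b∈R) (mulAffine∈R a∈R d∈R f∈R)

  taylorTail∈R : ∀ {a d f} → R a → R d → All R f → All R (taylorTail a d f)
  taylorTail∈R a∈R d∈R []          = []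
  taylorTail∈R a∈R d∈R (b∈R ∷ f∈R) =
    addConst∈R (evalDeriv∈R f∈R a∈R) (mulAffine∈R a∈R d∈R (taylorTail∈R a∈R d∈R f∈R))

  taylorQuotient∈R : ∀ {a d t f} → R a → R d → R t → All R f → All R (taylorQuotient a d t f)
  taylorQuotient∈R a∈R d∈R t∈R f∈R =
    *∈ d∈R t∈R ∷ evalDeriv∈R f∈R a∈R ∷ scale∈R d∈R (taylorTail∈R a∈R d∈R f∈R)

  infix 4 _∣ᴿ_
  _∣ᴿ_ : Carrier → Carrier → Set (c ⊔ ℓ ⊔ r)
  u ∣ᴿ x = ∃ λ t → R t × x ≈ u * t

  ∣ᴿ-*ʳ : ∀ {u x y} → u ∣ᴿ x → R y → u ∣ᴿ x * y
  ∣ᴿ-*ʳ {u} {x} {y} (t , t∈R , x≈ut) y∈R =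
    t * y , *∈ t∈R y∈R , trans (*-cong x≈ut refl) (*-assoc u t y)

  Basic-0⇒∣ᴿ : ∀ {u x} → Basic R u 0# x → u ∣ᴿ x
  Basic-0⇒∣ᴿ (t , t∈R , x≈ut+0) = t , t∈R , trans x≈ut+0 (+-identityʳ _)

  Basic-translate : ∀ {a b x z} → a ∣ᴿ z → Basic R a b x → Basic R a b (x + z)
  Basic-translate {a} {b} {x} {z} (t , t∈R , z≈at) (s , s∈R , x≈as+b) =
    s + t , +∈ s∈R t∈R , (begin
      x + z                ≈⟨ +-cong x≈as+b z≈at ⟩
      (a * s + b) + a * t  ≈⟨ solve 4 (λ a s b t → (a :* s :+ b) :+ a :* t := a :* (s :+ t) :+ b) refl a s b t ⟩
      a * (s + t) + b      ∎)

  multiples-nbhd : ∀ {u} → ¬ u ≈ 0# → IsNbhd R (Basic R u 0#) 0#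
  multiples-nbhd {u} u≉0 =
    u , 0# , u≉0 , (0# , 0∈ , sym (trans (+-identityʳ _) (zeroʳ u))) , λ x∈O → x∈O

  𝔪-resp : ∀ {x y} → x ≈ y → 𝔪 R x → 𝔪 R y
  𝔪-resp {x} {y} x≈y (x∈R , x∉U) = resp x≈y x∈R , λ { (_ , w , w∈R , yw≈1) →
    x∉U (x∈R , w , w∈R , trans (*-cong x≈y refl) yw≈1) }

  𝔪-*ʳ : ∀ {z t} → 𝔪 R z → R t → 𝔪 R (z * t)
  𝔪-*ʳ {z} {t} (z∈R , z∉U) t∈R = *∈ z∈R t∈R , λ { (_ , w , w∈R , ztw≈1) →
    z∉U (z∈R , t * w , *∈ t∈R w∈R , trans (sym (*-assoc z t w)) ztw≈1) }

  -1-unit : UnitR R (- 1#)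
  -1-unit = -∈ 1∈ , - 1# , -∈ 1∈ , trans (-1*x≈-x (- 1#)) (-‿involutive 1#)

  pow-unit : ∀ {u} n → UnitR R u → UnitR R (pow u n)
  pow-unit zero    _ = 1∈ , 1# , 1∈ , *-identityˡ 1#
  pow-unit {u} (suc n) u-unit@(u∈R , v , v∈R , uv≈1) with pow-unit n u-unit
  ... | p∈R , w , w∈R , pw≈1 = *∈ u∈R p∈R , v * w , *∈ v∈R w∈R , (begin
    (u * p) * (v * w)  ≈⟨ solve 4 (λ u p v w → (u :* p) :* (v :* w) := (u :* v) :* (p :* w)) refl u p v w ⟩
    (u * v) * (p * w)  ≈⟨ *-cong uv≈1 pw≈1 ⟩
    1# * 1#            ≈⟨ *-identityˡ 1# ⟩
    1#                 ∎)
    where p = pow u n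

  unit+𝔪∉𝔪 : IsLocal R → ∀ {u m} → UnitR R u → 𝔪 R m → ¬ 𝔪 R (u + m)
  unit+𝔪∉𝔪 local {u} {m} u-unit m∈𝔪 u+m∈𝔪 =
    proj₂ (𝔪-resp cancel (local u+m∈𝔪 (𝔪-*ʳ m∈𝔪 (-∈ 1∈)))) u-unit
    where
    cancel : (u + m) + m * - 1# ≈ u
    cancel = begin
      (u + m) + m * - 1#  ≈⟨ +-cong refl (trans (sym (-‿distribʳ-* m 1#)) (-‿cong (*-identityʳ m))) ⟩
      (u + m) + - m       ≈⟨ +-assoc u m (- m) ⟩
      u + (m + - m)       ≈⟨ +-cong refl (-‿inverseʳ m) ⟩
      u + 0#              ≈⟨ +-identityʳ u ⟩
      u                   ∎

  ∃-nonzero-nonunit : IsFractionField R → IsProper R → ∃ λ d → 𝔪 R d × ¬ d ≈ 0#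
  ∃-nonzero-nonunit fraction (x , x∉R) with fraction x
  ... | u , v , u∈R , v∈R , v≉0 , xv≈u = v , (v∈R , v-nonunit) , v≉0
    where
    v-nonunit : ¬ UnitR R v
    v-nonunit (_ , w , w∈R , vw≈1) = x∉R (resp (sym x≈uw) (*∈ u∈R w∈R))
      where
      x≈uw : x ≈ u * w
      x≈uw = begin
        x            ≈⟨ sym (*-identityʳ x) ⟩
        x * 1#       ≈⟨ *-cong refl (sym vw≈1) ⟩
        x * (v * w)  ≈⟨ sym (*-assoc x v w) ⟩
        (x * v) * w  ≈⟨ *-cong xv≈u refl ⟩
        u * w        ∎

  ∃-nonzero-nonunit-multiple : IsFractionField R → IsProper R → ∀ {a} → ¬ a ≈ 0# →
    ∃ λ d → 𝔪 R d × ¬ d ≈ 0# × a ∣ᴿ d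
  ∃-nonzero-nonunit-multiple fraction proper {a} a≉0
    with ∃-nonzero-nonunit fraction proper | fraction a
  ... | d , d∈𝔪 , d≉0 | s , t , s∈R , t∈R , t≉0 , at≈s =
    d * s , 𝔪-*ʳ d∈𝔪 s∈R , *-≉0 d≉0 s≉0 , t * d , *∈ t∈R (proj₁ d∈𝔪) , ds≈atd
    where
    s≉0 : ¬ s ≈ 0#
    s≉0 s≈0 = t≉0 (x*y≈0⇒y≈0 a≉0 (trans at≈s s≈0))
    ds≈atd : d * s ≈ a * (t * d)
    ds≈atd = trans (*-cong refl (sym at≈s))
      (solve 3 (λ d a t → d :* (a :* t) := a :* (t :* d)) refl d a t)

  henselian-root-near : IsHenselian R → ∀ {f a d} → All R f → R a → 𝔪 R d →
    (d * d) ∣ᴿ eval f a → ¬ 𝔪 R (evalDeriv f a) → ∃ λ y → R y × eval f (a + d * y) ≈ 0#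
  henselian-root-near henselian {f} {a} {d} f∈R a∈R d∈𝔪@(d∈R , _) (t , t∈R , fa≈d²t) f′a∉𝔪
    with henselian g (taylorQuotient∈R a∈R d∈R t∈R f∈R) 0# 0∈ g0∈𝔪 g′0∉𝔪
    where
    g = taylorQuotient a d t f
    g-tail = map (d *_) (taylorTail a d f)
    g0∈𝔪 : 𝔪 R (eval g 0#)
    g0∈𝔪 = 𝔪-resp (sym (eval-at-0 (d * t) (evalDeriv f a ∷ g-tail))) (𝔪-*ʳ d∈𝔪 t∈R)
    g′0∉𝔪 : ¬ 𝔪 R (eval (deriv g) 0#)
    g′0∉𝔪 g′0∈𝔪 = f′a∉𝔪 (𝔪-resp (eval-deriv-at-0 (d * t) (evalDeriv f a) g-tail) g′0∈𝔪)
  ... | y , y∈R , gy≈0 , _ = y , y∈R , (begin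
    eval f (a + d * y)                    ≈⟨ eval-taylorQuotient f a d t y fa≈d²t ⟩
    d * eval (taylorQuotient a d t f) y   ≈⟨ *-cong refl gy≈0 ⟩
    d * 0#                                ≈⟨ zeroʳ d ⟩
    0#                                    ∎)

  gtList : (n : ℕ) → (Fin n → Carrier) → Poly
  gtList zero    as = 1# ∷ 1# ∷ []
  gtList (suc n) as = as zero ∷ gtList n (λ i → as (suc i))

  eval-gtList : ∀ n as x → eval (gtList n as) x ≈ gtPoly R n as x
  eval-gtList zero    as x =
    solve 1 (λ x → con 1 :+ x :* (con 1 :+ x :* con 0) := x :* con 1 :+ con 1 :+ con 0) refl x
  eval-gtList (suc n) as x = begin
      as zero + x * eval (gtList n as′) x
    ≈⟨ +-cong refl (*-cong refl (eval-gtList n as′ x)) ⟩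
      as zero + x * (x * xⁿ + xⁿ + S)
    ≈⟨ solve 4 (λ a x P S → a :+ x :* (x :* P :+ P :+ S) := x :* (x :* P) :+ x :* P :+ (a :* con 1 :+ x :* S))
         refl (as zero) x xⁿ S ⟩
      x * (x * xⁿ) + x * xⁿ + (as zero * 1# + x * S)
    ≈⟨ +-cong refl (+-cong refl (sym (Σ-pull-factor as′ (λ i → pow x (toℕ i)) x))) ⟩
      gtPoly R (suc n) as x
    ∎
    where
    as′ = λ i → as (suc i)
    xⁿ = pow x n
    S = Σ[ (λ i → as′ i * pow x (toℕ i)) ]

  module _ {u : Carrier} where

    gtList∈R : ∀ n {as} → R u → (∀ i → u ∣ᴿ as i) → All R (gtList n as)
    gtList∈R zero    u∈R u∣as = 1∈ ∷ 1∈ ∷ []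
    gtList∈R (suc n) u∈R u∣as with u∣as zero
    ... | t , t∈R , a≈ut = resp (sym a≈ut) (*∈ u∈R t∈R) ∷ gtList∈R n u∈R (λ i → u∣as (suc i))

    gtList-at-−1 : ∀ n {as} → (∀ i → u ∣ᴿ as i) → u ∣ᴿ eval (gtList n as) (- 1#)
    gtList-at-−1 zero    u∣as = 0# , 0∈ , (begin
      1# + - 1# * (1# + - 1# * 0#)  ≈⟨ solve 1 (λ e → con 1 :+ e :* (con 1 :+ e :* con 0) := con 1 :+ e) refl (- 1#) ⟩
      1# + - 1#                     ≈⟨ -‿inverseʳ 1# ⟩
      0#                            ≈⟨ sym (zeroʳ u) ⟩
      u * 0#                        ∎)
    gtList-at-−1 (suc n) u∣as with u∣as zero | gtList-at-−1 n (λ i → u∣as (suc i))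
    ... | s , s∈R , a≈us | t , t∈R , f≈ut = s + - 1# * t , +∈ s∈R (*∈ (-∈ 1∈) t∈R) ,
      trans (+-cong a≈us (*-cong refl f≈ut))
        (solve 4 (λ u s e t → u :* s :+ e :* (u :* t) := u :* (s :+ e :* t)) refl u s (- 1#) t)

    gtList-deriv-at-−1 : ∀ n {as} → (∀ i → u ∣ᴿ as i) →
      ∃ λ t → R t × evalDeriv (gtList n as) (- 1#) ≈ pow (- 1#) n + u * t
    gtList-deriv-at-−1 zero    u∣as = 0# , 0∈ ,
      solve 2 (λ e u → (con 1 :+ e :* con 0) :+ e :* (con 0 :+ e :* con 0) := con 1 :+ u :* con 0) refl (- 1#) u
    gtList-deriv-at-−1 (suc n) u∣as
      with gtList-at-−1 n (λ i → u∣as (suc i)) | gtList-deriv-at-−1 n (λ i → u∣as (suc i))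
    ... | s , s∈R , f≈us | t , t∈R , f′≈eⁿ+ut = s + - 1# * t , +∈ s∈R (*∈ (-∈ 1∈) t∈R) ,
      trans (+-cong f≈us (*-cong refl f′≈eⁿ+ut))
        (solve 5 (λ u s e p t → u :* s :+ e :* (p :+ u :* t) := e :* p :+ u :* (s :+ e :* t))
           refl u s (- 1#) (pow (- 1#) n) t)

  gtList-deriv-at-−1∉𝔪 : IsLocal R → ∀ n {as u} → 𝔪 R u → (∀ i → u ∣ᴿ as i) →
    ¬ 𝔪 R (evalDeriv (gtList n as) (- 1#))
  gtList-deriv-at-−1∉𝔪 local n u∈𝔪 u∣as f′∈𝔪 with gtList-deriv-at-−1 n u∣as
  ... | t , t∈R , f′≈eⁿ+ut =
    unit+𝔪∉𝔪 local (pow-unit n -1-unit) (𝔪-*ʳ u∈𝔪 t∈R) (𝔪-resp f′≈eⁿ+ut f′∈𝔪)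

  gtPoly-root-near-−1 : IsLocal R → IsHenselian R → ∀ n {as d} → 𝔪 R d → (∀ i → (d * d) ∣ᴿ as i) →
    ∃ λ y → R y × gtPoly R n as (- 1# + d * y) ≈ 0#
  gtPoly-root-near-−1 local henselian n {as} {d} d∈𝔪@(d∈R , _) d²∣as =
    let y , y∈R , fy≈0 = henselian-root-near henselian (gtList∈R n (*∈ d∈R d∈R) d²∣as) (-∈ 1∈) d∈𝔪
                           (gtList-at-−1 n d²∣as) (gtList-deriv-at-−1∉𝔪 local n (𝔪-*ʳ d∈𝔪 d∈R) d²∣as)
    in y , y∈R , trans (sym (eval-gtList n as (- 1# + d * y))) fy≈0

proposition8p5 : ∀ {c ℓ r : Level} (K : Field c ℓ) (R : Pred (Field.Carrier K) r) →
    FieldTheory.IsSubring K R → FieldTheory.IsLocal K R → FieldTheory.IsHenselian K R →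
    FieldTheory.IsFractionField K R → FieldTheory.IsProper K R →
    FieldTheory.IsGtHenselian K R
proposition8p5 K R R-subring local henselian fraction proper n P (a , b , a≉0 , −1∈aR+b , aR+b⊆P) =
  let d , d∈𝔪 , d≉0 , a∣d = ∃-nonzero-nonunit-multiple fraction proper a≉0
  in Basic R (d * d) 0# , multiples-nbhd (*-≉0 d≉0 d≉0) , λ as as∈d²R →
       let y , y∈R , root-y = gtPoly-root-near-−1 local henselian n d∈𝔪 (λ i → Basic-0⇒∣ᴿ (as∈d²R i))
       in - 1# + d * y , aR+b⊆P (Basic-translate (∣ᴿ-*ʳ a∣d y∈R) −1∈aR+b) , root-y
  where
  open Field K using (_*_; _+_; -_; 0#; 1#)
  open FieldTheory K using (Basic)
  open Subrings K R R-subring
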